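{- If every clause of a CNF formula $A$ is superirredundant in $A$, then $A$ is minimal.
   Context: A CNF formula is a finite set of clauses; a clause is a finite set of literals, read as their disjunction. Tautological clauses are not allowed in formulae. The size of a formula is the number of literal occurrences in it; a CNF formula $A$ is minimal if no CNF formula equivalent to $A$ has smaller size. Resolution: from clauses $c_1 \vee l$ and $c_2 \vee \neg l$ derive $c_1 \vee c_2$; two clauses whose resolvent would be a tautology are considered not to resolve. The resolution closure $\mathrm{ResCn}(F)$ is the set of all clauses obtainable from $F$ by zero or more resolution steps. A clause $c \in F$ is superredundant in $F$ if $\mathrm{ResCn}(F) \setminus \{c\} \models c$, and superirredundant otherwise. -}

module Defs where

open import Data.Nat using (ℕ; _≤_)
open import Data.Bool using (Bool; true; false; not; T; _∨_)
open import Data.Product using (_×_; _,_; ∃; ∃-syntax)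
open import Data.Sum using (_⊎_)
open import Data.List using (List; length; map)
open import Data.Nat.ListAction using (sum)
open import Data.List.Membership.Propositional using (_∈_)
open import Data.List.Relation.Unary.Any using (Any)
open import Data.List.Relation.Unary.All using (All)
open import Data.List.Relation.Unary.AllPairs using (AllPairs)
open import Data.List.Relation.Unary.Unique.Propositional using (Unique)
open import Relation.Binary.PropositionalEquality using (_≡_; _≢_)
open import Relation.Nullary using (¬_)
open import Function.Bundles using (_⇔_)

-- Variables are natural numbers; a literal is a variable with a polarity
-- (true = positive literal x, false = negative literal ¬x).
Var : Set
Var = ℕ

Literal : Set
Literal = Var × Bool

neg : Literal → Literal
neg (v , b) = (v , not b)

-- A clause is a finite set of literals, represented by a list; set semantics
-- (order and multiplicity irrelevant) is imposed via WFClause / ≈ below.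
Clause : Set
Clause = List Literal

Formula : Set
Formula = List Clause

_≈_ : Clause → Clause → Set
c ≈ d = ∀ (l : Literal) → (l ∈ c) ⇔ (l ∈ d)

Tautological : Clause → Set
Tautological c = ∃[ v ] ((v , true) ∈ c × (v , false) ∈ c)

WFClause : Clause → Set
WFClause c = Unique c × ¬ Tautological c

WFFormula : Formula → Set
WFFormula A = All WFClause A × AllPairs (λ c d → ¬ (c ≈ d)) A

size : Formula → ℕ
size A = sum (map length A)

Assignment : Set
Assignment = Var → Bool

SatLit : Assignment → Literal → Set
SatLit σ (v , true)  = T (σ v)
SatLit σ (v , false) = T (not (σ v))

SatClause : Assignment → Clause → Set
SatClause σ c = Any (SatLit σ) c

SatFormula : Assignment → Formula → Set
SatFormula σ A = All (SatClause σ) A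

Equiv : Formula → Formula → Set
Equiv A B = ∀ (σ : Assignment) → SatFormula σ A ⇔ SatFormula σ B

Minimal : Formula → Set
Minimal A = ∀ (B : Formula) → WFFormula B → Equiv A B → size A ≤ size B

IsResolvent : Clause → Clause → Literal → Clause → Set
IsResolvent d₁ d₂ l e =
  ∀ (x : Literal) → (x ∈ e) ⇔ ((x ∈ d₁ × x ≢ l) ⊎ (x ∈ d₂ × x ≢ neg l))

-- ResCn F: clauses obtainable by zero or more resolution steps
-- (up to set equality of clauses); tautological resolvents are excluded,
-- since such pairs of clauses are considered not to resolve.
data ResCn (F : Formula) : Clause → Set where
  base : ∀ {c e} → c ∈ F → e ≈ c → ResCn F e
  step : ∀ {d₁ d₂ e} (l : Literal) → ResCn F d₁ → ResCn F d₂ →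
         l ∈ d₁ → neg l ∈ d₂ → IsResolvent d₁ d₂ l e →
         ¬ Tautological e → ResCn F e

Superredundant : Formula → Clause → Set
Superredundant F c =
  ∀ (σ : Assignment) →
    (∀ (d : Clause) → ResCn F d → ¬ (d ≈ c) → SatClause σ d) →
    SatClause σ c

Superirredundant : Formula → Clause → Set
Superirredundant F c = ¬ Superredundant F c

{-# OPTIONS --safe #-}
-- Let B be equivalent to A. For a clause c of A, superirredundance yields an
-- assignment σ that falsifies c but satisfies every other clause of ResCn(A).
-- Then σ falsifies some clause d of B. Since A ⊨ d, the subsumption theorem
-- gives a clause p ∈ ResCn(A) with p ⊆ d; σ falsifies p, so p is c, and hence
-- c ⊆ d. Different clauses of A are sent to different clauses of B (σ
-- satisfies every c′ ≠ c, hence every clause containing it), so the clauses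
-- of A embed injectively into those of B, each into a superset, and
-- size A ≤ size B.
module Submission where

open import Defs
open import Data.List.Membership.Propositional using (_∈_; _∉_)

open import Data.Nat using (suc; _+_; _≤_; _≤?_; z≤n; s≤s)
import Data.Nat.Properties as ℕ
open import Algebra.Properties.CommutativeSemigroup ℕ.+-commutativeSemigroup
  using (x∙yz≈y∙xz)
open import Data.Bool using (true; false; not)
import Data.Bool.Properties as Bool
open import Data.Unit using (tt)
open import Data.Empty using (⊥-elim)
open import Data.Product using (_×_; _,_; ∃; ∃-syntax; proj₁; proj₂)
open import Data.Product.Properties using (≡-dec)
open import Data.Sum using (_⊎_; inj₁; inj₂)
open import Data.List using (List; []; _∷_; _++_; length; map; concat; filter)
open import Data.List.Properties using (length-removeAt′)
open import Data.Nat.ListAction using (sum)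
open import Data.List.Membership.Propositional using (find; lose)
open import Data.List.Membership.Propositional.Properties
  using (∈-++⁺ˡ; ∈-++⁺ʳ; ∈-++⁻; ∈-map⁺; ∈-concat⁺′; ∈-filter⁺; ∈-filter⁻)
open import Data.List.Relation.Binary.Subset.Propositional using (_⊆_)
open import Data.List.Relation.Binary.Subset.Propositional.Properties
  using (Any-resp-⊆)
open import Data.List.Relation.Unary.Any using (here; there; any?; index; _─_)
open import Data.List.Relation.Unary.All using (All; []; _∷_)
import Data.List.Relation.Unary.All as All
open import Data.List.Relation.Unary.All.Properties using (¬All⇒Any¬)
open import Data.List.Relation.Unary.AllPairs using (AllPairs; []; _∷_)
import Data.List.Relation.Unary.AllPairs as AllPairs
open import Data.List.Relation.Unary.Unique.Propositional using (Unique)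
open import Relation.Binary.PropositionalEquality
  using (_≡_; _≢_; refl; sym; trans; cong; subst)
open import Relation.Binary.Definitions using (DecidableEquality)
open import Relation.Nullary using (¬_; Dec; yes; no; does; ¬?)
open import Relation.Nullary.Decidable using (T?; decidable-stable)
open import Relation.Nullary.Negation using (¬¬-map)
open import Relation.Unary using (Decidable)
open import Function using (_∘_)
open import Function.Bundles using (mk⇔; Equivalence)
import Function.Properties.Equivalence as ⇔

_≟ₗ_ : DecidableEquality Literal
_≟ₗ_ = ≡-dec ℕ._≟_ Bool._≟_

open import Data.List.Membership.DecPropositional _≟ₗ_ using (_∈?_)

module _ {X : Set} where

  ∈-─ : ∀ {x y : X} {xs} (x∈xs : x ∈ xs) → y ∈ xs → y ≢ x → y ∈ (xs ─ x∈xs)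
  ∈-─ (here refl)  (here refl)  y≢x = ⊥-elim (y≢x refl)
  ∈-─ (here refl)  (there y∈xs) _   = y∈xs
  ∈-─ (there x∈xs) (here refl)  _   = here refl
  ∈-─ (there x∈xs) (there y∈xs) y≢x = there (∈-─ x∈xs y∈xs y≢x)

  ∈-∷-≢ : ∀ {x y : X} {xs} → x ∈ y ∷ xs → x ≢ y → x ∈ xs
  ∈-∷-≢ (here x≡y)  x≢y = ⊥-elim (x≢y x≡y)
  ∈-∷-≢ (there x∈xs) _  = x∈xs

  Unique-⊆⇒length-≤ : ∀ {xs ys : List X} → Unique xs → xs ⊆ ys → length xs ≤ length ys
  Unique-⊆⇒length-≤ {[]}     _              _     = z≤n
  Unique-⊆⇒length-≤ {x ∷ xs} {ys} (x∉xs ∷ u) xs⊆ys = begin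
    suc (length xs)          ≤⟨ s≤s (Unique-⊆⇒length-≤ u xs⊆ys─x) ⟩
    suc (length (ys ─ x∈ys)) ≡⟨ sym (length-removeAt′ ys (index x∈ys)) ⟩
    length ys                ∎
    where
    open ℕ.≤-Reasoning
    x∈ys : x ∈ ys
    x∈ys = xs⊆ys (here refl)
    xs⊆ys─x : xs ⊆ (ys ─ x∈ys)
    xs⊆ys─x y∈xs = ∈-─ x∈ys (xs⊆ys (there y∈xs)) (All.lookup x∉xs y∈xs ∘ sym)

  sum-length-─ : ∀ {xs : List X} {xss} (xs∈xss : xs ∈ xss) →
                 sum (map length xss) ≡ length xs + sum (map length (xss ─ xs∈xss))
  sum-length-─ (here refl) = refl
  sum-length-─ {xs} {ys ∷ xss} (there xs∈xss) =
    trans (cong (length ys +_) (sum-length-─ xs∈xss))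
          (x∙yz≈y∙xz (length ys) (length xs) _)

  AllPairs-with-∈ : ∀ {P : X → X → Set} {xs} → AllPairs P xs →
                    AllPairs (λ x y → y ∈ xs × P x y) xs
  AllPairs-with-∈ []           = []
  AllPairs-with-∈ (px ∷ pxs) =
    All.tabulate (λ y∈xs → there y∈xs , All.lookup px y∈xs)
    ∷ AllPairs.map (λ (y∈xs , pxy) → there y∈xs , pxy) (AllPairs-with-∈ pxs)

  ¬¬-All-tabulate : ∀ {P : X → Set} {xs} → (∀ {x} → x ∈ xs → ¬ ¬ P x) → ¬ ¬ All P xs
  ¬¬-All-tabulate {xs = []}     _     ¬all = ¬all []
  ¬¬-All-tabulate {xs = x ∷ xs} ¬¬px ¬all =
    ¬¬px (here refl) (λ px → ¬¬-All-tabulate (¬¬px ∘ there) (¬all ∘ (px ∷_)))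

module _ {X : Set} (R : List X → List X → Set) (R⇒⊆ : ∀ {xs ys} → R xs ys → xs ⊆ ys) where

  injective-cover⇒sum-length-≤ :
    ∀ {A B : List (List X)} → All Unique A →
    AllPairs (λ xs xs′ → ∀ {ys ys′} → R xs ys → R xs′ ys′ → ys ≢ ys′) A →
    All (λ xs → ∃[ ys ] (ys ∈ B × R xs ys)) A →
    sum (map length A) ≤ sum (map length B)
  injective-cover⇒sum-length-≤ {[]} _ _ _ = z≤n
  injective-cover⇒sum-length-≤ {xs ∷ A} {B} (u ∷ us) (sep ∷ seps) ((ys , ys∈B , r) ∷ covs) =
    begin
      length xs + sum (map length A)
        ≤⟨ ℕ.+-mono-≤ (Unique-⊆⇒length-≤ u (R⇒⊆ r))
                      (injective-cover⇒sum-length-≤ us seps covs′) ⟩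
      length ys + sum (map length (B ─ ys∈B))
        ≡⟨ sym (sum-length-─ ys∈B) ⟩
      sum (map length B)
    ∎
    where
    open ℕ.≤-Reasoning
    covs′ : All (λ xs′ → ∃[ ys′ ] (ys′ ∈ (B ─ ys∈B) × R xs′ ys′)) A
    covs′ = All.zipWith (λ (sep′ , (ys′ , ys′∈B , r′)) →
                           ys′ , ∈-─ ys∈B ys′∈B (sep′ r r′ ∘ sym) , r′)
                        (sep , covs)

≈-refl : ∀ {c} → c ≈ c
≈-refl _ = ⇔.refl

≈-sym : ∀ {c d} → c ≈ d → d ≈ c
≈-sym c≈d l = ⇔.sym (c≈d l)

satLit? : ∀ σ → Decidable (SatLit σ)
satLit? σ (v , true)  = T? (σ v)
satLit? σ (v , false) = T? (not (σ v))

satClause? : ∀ σ → Decidable (SatClause σ)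
satClause? σ = any? (satLit? σ)

falsified-polarity-unique : ∀ σ {v b b′} →
  ¬ SatLit σ (v , b) → ¬ SatLit σ (v , b′) → b ≡ b′
falsified-polarity-unique σ {b = true}  {true}  _ _ = refl
falsified-polarity-unique σ {b = false} {false} _ _ = refl
falsified-polarity-unique σ {v} {true} {false} ¬t ¬f with σ v
... | true  = ⊥-elim (¬t tt)
... | false = ⊥-elim (¬f tt)
falsified-polarity-unique σ {v} {false} {true} ¬f ¬t with σ v
... | true  = ⊥-elim (¬t tt)
... | false = ⊥-elim (¬f tt)

falsifier : Clause → Assignment
falsifier d v = does ((v , false) ∈? d)

falsifier-falsifies : ∀ {d} → ¬ Tautological d → ∀ {l} → l ∈ d → ¬ SatLit (falsifier d) l
falsifier-falsifies {d} ¬taut {v , true} vt∈d with (v , false) ∈? d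
... | yes vf∈d = λ _ → ¬taut (v , vt∈d , vf∈d)
... | no _     = λ ()
falsifier-falsifies {d} ¬taut {v , false} vf∈d with (v , false) ∈? d
... | yes _    = λ ()
... | no vf∉d  = ⊥-elim (vf∉d vf∈d)

⊆-¬Tautological : ∀ {c d} → c ⊆ d → ¬ Tautological d → ¬ Tautological c
⊆-¬Tautological c⊆d ¬taut (v , vt∈c , vf∈c) = ¬taut (v , c⊆d vt∈c , c⊆d vf∈c)

∷-¬Tautological : ∀ {l d} → neg l ∉ d → ¬ Tautological d → ¬ Tautological (l ∷ d)
∷-¬Tautological _    _     (v , here refl  , here ())
∷-¬Tautological     ¬l∉d ¬taut (v , here refl  , there vf∈d) = ¬l∉d vf∈d
∷-¬Tautological     ¬l∉d ¬taut (v , there vt∈d , here refl)  = ¬l∉d vt∈d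
∷-¬Tautological     ¬l∉d ¬taut (v , there vt∈d , there vf∈d) = ¬taut (v , vt∈d , vf∈d)

resolvent : Clause → Clause → Literal → Clause
resolvent d₁ d₂ l = filter (¬? ∘ (_≟ₗ l)) d₁ ++ filter (¬? ∘ (_≟ₗ neg l)) d₂

resolvent-isResolvent : ∀ d₁ d₂ l → IsResolvent d₁ d₂ l (resolvent d₁ d₂ l)
resolvent-isResolvent d₁ d₂ l x = mk⇔ to from
  where
  to : x ∈ resolvent d₁ d₂ l → (x ∈ d₁ × x ≢ l) ⊎ (x ∈ d₂ × x ≢ neg l)
  to x∈r with ∈-++⁻ (filter (¬? ∘ (_≟ₗ l)) d₁) x∈r
  ... | inj₁ x∈d₁′ = inj₁ (∈-filter⁻ (¬? ∘ (_≟ₗ l)) x∈d₁′)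
  ... | inj₂ x∈d₂′ = inj₂ (∈-filter⁻ (¬? ∘ (_≟ₗ neg l)) x∈d₂′)
  from : (x ∈ d₁ × x ≢ l) ⊎ (x ∈ d₂ × x ≢ neg l) → x ∈ resolvent d₁ d₂ l
  from (inj₁ (x∈d₁ , x≢l)) = ∈-++⁺ˡ (∈-filter⁺ (¬? ∘ (_≟ₗ l)) x∈d₁ x≢l)
  from (inj₂ (x∈d₂ , x≢¬l)) =
    ∈-++⁺ʳ (filter (¬? ∘ (_≟ₗ l)) d₁) (∈-filter⁺ (¬? ∘ (_≟ₗ neg l)) x∈d₂ x≢¬l)

resolvent-⊆ : ∀ {d₁ d₂ l d} → d₁ ⊆ l ∷ d → d₂ ⊆ neg l ∷ d → resolvent d₁ d₂ l ⊆ d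
resolvent-⊆ {d₁} {d₂} {l} d₁⊆ d₂⊆ {x} x∈r
  with Equivalence.to (resolvent-isResolvent d₁ d₂ l x) x∈r
... | inj₁ (x∈d₁ , x≢l)  = ∈-∷-≢ (d₁⊆ x∈d₁) x≢l
... | inj₂ (x∈d₂ , x≢¬l) = ∈-∷-≢ (d₂⊆ x∈d₂) x≢¬l

Subsumed : Formula → Clause → Set
Subsumed A d = ∃[ p ] (ResCn A p × p ⊆ d)

subsumed-cut : ∀ {A d} l → ¬ Tautological d →
  Subsumed A (l ∷ d) → Subsumed A (neg l ∷ d) → Subsumed A d
subsumed-cut l ¬taut (p₁ , p₁∈R , p₁⊆) (p₂ , p₂∈R , p₂⊆) with l ∈? p₁ | neg l ∈? p₂
... | no l∉p₁ | _ = p₁ , p₁∈R , λ x∈p₁ → ∈-∷-≢ (p₁⊆ x∈p₁) λ { refl → l∉p₁ x∈p₁ }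
... | yes _ | no ¬l∉p₂ = p₂ , p₂∈R , λ x∈p₂ → ∈-∷-≢ (p₂⊆ x∈p₂) λ { refl → ¬l∉p₂ x∈p₂ }
... | yes l∈p₁ | yes ¬l∈p₂ =
  resolvent p₁ p₂ l ,
  step l p₁∈R p₂∈R l∈p₁ ¬l∈p₂ (resolvent-isResolvent p₁ p₂ l) (⊆-¬Tautological r⊆d ¬taut) ,
  r⊆d
  where
  r⊆d : resolvent p₁ p₂ l ⊆ _
  r⊆d = resolvent-⊆ p₁⊆ p₂⊆

_⊨_ : Formula → Clause → Set
A ⊨ d = ∀ σ → SatFormula σ A → SatClause σ d

Mentions : Clause → Var → Set
Mentions d v = ∃[ b ] ((v , b) ∈ d)

mentions? : ∀ d v → Dec (Mentions d v)
mentions? d v with (v , true) ∈? d | (v , false) ∈? d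
... | yes vt∈d | _        = yes (true , vt∈d)
... | no _     | yes vf∈d = yes (false , vf∈d)
... | no vt∉d  | no vf∉d  = no λ { (true , vt∈d) → vt∉d vt∈d ; (false , vf∈d) → vf∉d vf∈d }

variables : Formula → List Var
variables A = map proj₁ (concat A)

VariablesAmong : Formula → List Var → Clause → Set
VariablesAmong A W d = ∀ {p v b} → p ∈ A → (v , b) ∈ p → v ∈ W ⊎ Mentions d v

falsifier-¬SatClause : ∀ {d} → ¬ Tautological d → ¬ SatClause (falsifier d) d
falsifier-¬SatClause ¬taut σd = let _ , l∈d , σl = find σd in falsifier-falsifies ¬taut l∈d σl

falsified-by-falsifier⇒⊆ : ∀ {d p} → ¬ Tautological d → ¬ SatClause (falsifier d) p →
  (∀ {v b} → (v , b) ∈ p → Mentions d v) → p ⊆ d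
falsified-by-falsifier⇒⊆ {d} ¬taut ¬σp mentioned {v , b} vb∈p =
  let b′ , vb′∈d = mentioned vb∈p
      b′≡b = falsified-polarity-unique (falsifier d)
               (falsifier-falsifies ¬taut vb′∈d) (¬σp ∘ lose vb∈p)
  in subst (λ b″ → (v , b″) ∈ d) b′≡b vb′∈d

⊨-mentioning-all⇒subsumed : ∀ {A d} → ¬ Tautological d → A ⊨ d →
  VariablesAmong A [] d → Subsumed A d
⊨-mentioning-all⇒subsumed {A} {d} ¬taut A⊨d among =
  let σ = falsifier d
      p , p∈A , ¬σp = find (¬All⇒Any¬ (satClause? σ) A (falsifier-¬SatClause ¬taut ∘ A⊨d σ))
  in p , base p∈A ≈-refl , falsified-by-falsifier⇒⊆ ¬taut ¬σp (mentioned p∈A)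
  where
  mentioned : ∀ {p} → p ∈ A → ∀ {v b} → (v , b) ∈ p → Mentions d v
  mentioned p∈A vb∈p with among p∈A vb∈p
  ... | inj₂ mentions = mentions

-- Split on a variable v of A not mentioned in d: both d ∨ v and d ∨ ¬v are
-- entailed, and resolving their subsumers on v yields a subsumer of d.
⊨⇒subsumed-among : ∀ {A d} W → ¬ Tautological d → A ⊨ d →
  VariablesAmong A W d → Subsumed A d
⊨⇒subsumed-among [] ¬taut A⊨d among = ⊨-mentioning-all⇒subsumed ¬taut A⊨d among
⊨⇒subsumed-among {A} {d} (v ∷ W) ¬taut A⊨d among with mentions? d v
... | yes (b , vb∈d) = ⊨⇒subsumed-among W ¬taut A⊨d among′
  where
  among′ : VariablesAmong A W d
  among′ p∈A l∈p with among p∈A l∈p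
  ... | inj₁ (here refl)  = inj₂ (b , vb∈d)
  ... | inj₁ (there u∈W) = inj₁ u∈W
  ... | inj₂ mentioned   = inj₂ mentioned
... | no ¬mentioned =
  subsumed-cut (v , true) ¬taut (branch true) (branch false)
  where
  branch : ∀ b → Subsumed A ((v , b) ∷ d)
  branch b = ⊨⇒subsumed-among W
    (∷-¬Tautological (λ v¬b∈d → ¬mentioned (not b , v¬b∈d)) ¬taut)
    (λ σ σA → there (A⊨d σ σA))
    among′
    where
    among′ : VariablesAmong A W ((v , b) ∷ d)
    among′ p∈A l∈p with among p∈A l∈p
    ... | inj₁ (here refl)  = inj₂ (b , here refl)
    ... | inj₁ (there u∈W) = inj₁ u∈W
    ... | inj₂ (b′ , ub′∈d) = inj₂ (b′ , there ub′∈d)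

⊨⇒subsumed : ∀ {A d} → ¬ Tautological d → A ⊨ d → Subsumed A d
⊨⇒subsumed {A} ¬taut A⊨d = ⊨⇒subsumed-among (variables A) ¬taut A⊨d
  λ p∈A l∈p → inj₁ (∈-map⁺ proj₁ (∈-concat⁺′ l∈p p∈A))

SatisfiesAllBut : Formula → Clause → Assignment → Set
SatisfiesAllBut A c σ = ∀ e → ResCn A e → ¬ e ≈ c → SatClause σ e

Isolates : Formula → Clause → Assignment → Set
Isolates A c σ = SatisfiesAllBut A c σ × ¬ SatClause σ c

superirredundant⇒¬¬isolated : ∀ {A c} → Superirredundant A c → ¬ ¬ ∃ (Isolates A c)
superirredundant⇒¬¬isolated {c = c} si ¬isolated =
  si λ σ others → decidable-stable (satClause? σ c) (λ ¬σc → ¬isolated (σ , others , ¬σc))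

module _ {A B : Formula} (wfB : WFFormula B) (A⇔B : Equiv A B) where

  Cover : Clause → Clause → Set
  Cover c d = c ⊆ d × ∃[ σ ] (SatisfiesAllBut A c σ × ¬ SatClause σ d)

  isolated⇒covered : ∀ {c} → c ∈ A → ∃ (Isolates A c) → ∃[ d ] (d ∈ B × Cover c d)
  isolated⇒covered {c} c∈A (σ , others , ¬σc) =
    let d , d∈B , ¬σd = find (¬All⇒Any¬ (satClause? σ) B ¬σB)
    in d , d∈B , c⊆ d∈B ¬σd , σ , others , ¬σd
    where
    ¬σB : ¬ SatFormula σ B
    ¬σB σB = ¬σc (All.lookup (Equivalence.from (A⇔B σ) σB) c∈A)
    -- The clause of ResCn(A) subsuming d is falsified by σ, so it is c.
    c⊆ : ∀ {d} → d ∈ B → ¬ SatClause σ d → c ⊆ d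
    c⊆ {d} d∈B ¬σd {x} x∈c with x ∈? d
    ... | yes x∈d = x∈d
    ... | no x∉d =
      let A⊨d = λ τ τA → All.lookup (Equivalence.to (A⇔B τ) τA) d∈B
          p , p∈R , p⊆d = ⊨⇒subsumed (proj₂ (All.lookup (proj₁ wfB) d∈B)) A⊨d
          p≉c = λ p≈c → x∉d (p⊆d (Equivalence.from (p≈c x) x∈c))
      in ⊥-elim (¬σd (Any-resp-⊆ p⊆d (others p p∈R p≉c)))

  covers-separated : ∀ {c c′ d d′} → c′ ∈ A → ¬ c ≈ c′ → Cover c d → Cover c′ d′ → d ≢ d′
  covers-separated {c′ = c′} c′∈A c≉c′ (_ , σ , others , ¬σd) (c′⊆d′ , _) refl =
    ¬σd (Any-resp-⊆ c′⊆d′ (others c′ (base c′∈A ≈-refl) (c≉c′ ∘ ≈-sym)))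

  covered⇒size-≤ : WFFormula A → All (λ c → ∃[ d ] (d ∈ B × Cover c d)) A → size A ≤ size B
  covered⇒size-≤ (wfA , distinct) =
    injective-cover⇒sum-length-≤ Cover proj₁ (All.map proj₁ wfA)
      (AllPairs.map (λ (c′∈A , c≉c′) {_} {_} → covers-separated c′∈A c≉c′)
                    (AllPairs-with-∈ distinct))

lemma5 : (A : Formula) → WFFormula A →
    (∀ (c : Clause) → c ∈ A → Superirredundant A c) →
    Minimal A
lemma5 A wfA si B wfB A⇔B =
  decidable-stable (size A ≤? size B) λ size≰ →
    ¬¬-All-tabulate
      (λ {c} c∈A → ¬¬-map (isolated⇒covered wfB A⇔B c∈A) (superirredundant⇒¬¬isolated (si c c∈A)))
      (size≰ ∘ covered⇒size-≤ wfB A⇔B wfA)
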